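{- Let $O=\{o_1,\ldots,o_r\}$ and $V=\{v_1,\ldots,v_n\}$ be disjoint sets of labeled vertices, and let $F:V\to\binom{O\cup V}{r}$ assign to each $v\in V$ an $r$-element subset of $O\cup V$. There exists an $O$-rooted labeled $r$-tree $T$ on $O\cup V$ with $F(v_i)=F_T(v_i)$ for all $i\in[n]$ if and only if $F$ satisfies: - (a) for any $j\ge1$ and any indices $i_1,\ldots,i_j\in[n]$, if $v_{i_1}\in F(v_{i_2}),\ldots,v_{i_{j-1}}\in F(v_{i_j})$, then $v_{i_j}\notin F(v_{i_1})$; - (b) if $F(v_j)\ne O$, then there is a vertex $v_i\in F(v_j)$ with $|F(v_j)\cap F(v_i)|=r-1$. Moreover, the $r$-tree $T$ and the vertex $v_i$ in (b) are unique.
   Context: An $O$-rooted labeled $r$-tree on $O\cup V$ is a graph $T$ on $O\cup V$ admitting a valid rearrangement. A valid rearrangement is an ordering $\nu=(v_{i_1},\ldots,v_{i_n})$ of $v_1,\ldots,v_n$ such that, for each $j\in[n]$, $v_{i_j}$ is adjacent to exactly $r$ vertices of $\{o_1,\ldots,o_r,v_{i_1},\ldots,v_{i_{j-1}}\}$, and these $r$ vertices are mutually adjacent in $T$. These $r$ vertices form the father set of $v_{i_j}$. The father set is independent of the valid rearrangement and is denoted $F_T(v_{i_j})$. -}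

module Defs where

open import Data.Nat using (ℕ; zero; suc; _+_; _∸_; _<?_)
open import Data.Bool using (Bool; true; false; _∨_)
open import Data.Fin using (Fin; toℕ; splitAt; _↑ˡ_; _↑ʳ_; inject₁; fromℕ) renaming (zero to fzero; suc to fsuc)
open import Data.Fin.Subset using (Subset; _∈_; _∉_; _∩_; ∣_∣)
open import Data.Fin.Permutation using (Permutation′; _⟨$⟩ˡ_)
open import Data.Vec using (tabulate)
open import Data.Sum using (inj₁; inj₂; [_,_])
open import Data.Product using (Σ; _×_; ∃; proj₁; proj₂)
open import Relation.Binary.PropositionalEquality using (_≡_; _≢_)
open import Relation.Nullary using (does; ¬_)

-- Vertex set O ∪ V is Fin (r + n): o_k = k ↑ˡ n, v_i = r ↑ʳ i.
o : ∀ {r} n → Fin r → Fin (r + n)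
o n k = k ↑ˡ n

v : ∀ r {n} → Fin n → Fin (r + n)
v r i = r ↑ʳ i

Oset : ∀ r n → Subset (r + n)
Oset r n = tabulate λ x → [ (λ _ → true) , (λ _ → false) ] (splitAt r x)

record Graph (m : ℕ) : Set where
  field
    adj    : Fin m → Fin m → Bool
    sym    : ∀ x y → adj x y ≡ adj y x
    irrefl : ∀ x → adj x x ≡ false
open Graph public

N : ∀ {m} → Graph m → Fin m → Subset m
N T x = tabulate (adj T x)

Clique : ∀ {m} → Graph m → Subset m → Set
Clique T S = ∀ x y → x ∈ S → y ∈ S → x ≢ y → adj T x y ≡ true

-- For an ordering ν of V (ν ⟨$⟩ʳ j = index of the j-th vertex), the set
-- {o_1..o_r} ∪ {vertices of V strictly before v_i in ν}.
Before : ∀ r {n} → Permutation′ n → Fin n → Subset (r + n)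
Before r ν i = tabulate λ x →
  [ (λ _ → true) , (λ i′ → does (toℕ (ν ⟨$⟩ˡ i′) <? toℕ (ν ⟨$⟩ˡ i))) ] (splitAt r x)

Fathers : ∀ r {n} → Graph (r + n) → Permutation′ n → Fin n → Subset (r + n)
Fathers r T ν i = N T (v r i) ∩ Before r ν i

ValidRearrangement : ∀ r {n} → Graph (r + n) → Permutation′ n → Set
ValidRearrangement r T ν =
  ∀ i → (∣ Fathers r T ν i ∣ ≡ r) × Clique T (Fathers r T ν i)

-- O-rooted labeled r-tree on O ∪ V (the root O is required to be an r-clique).
IsORootedRTree : ∀ r n → Graph (r + n) → Set
IsORootedRTree r n T = Clique T (Oset r n) × Σ (Permutation′ n) (ValidRearrangement r T)

-- Father set F_T(v_i), computed from the valid rearrangement carried by the proof.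
FatherSet : ∀ r {n} (T : Graph (r + n)) → IsORootedRTree r n T → Fin n → Subset (r + n)
FatherSet r T isT i = Fathers r T (proj₁ (proj₂ isT)) i

-- Condition (a): for j = suc k ≥ 1 and indices is(0..k), if
-- v_{is 0} ∈ F(v_{is 1}), …, v_{is (k-1)} ∈ F(v_{is k}), then v_{is k} ∉ F(v_{is 0}).
CondA : ∀ r {n} → (Fin n → Subset (r + n)) → Set
CondA r {n} F = ∀ (k : ℕ) (is : Fin (suc k) → Fin n) →
  (∀ (m : Fin k) → v r (is (inject₁ m)) ∈ F (is (fsuc m))) →
  v r (is (fromℕ k)) ∉ F (is fzero)

CondB : ∀ r {n} → (Fin n → Subset (r + n)) → Set
CondB r {n} F = ∀ (j : Fin n) → F j ≢ Oset r n →
  ∃ λ (i : Fin n) → (v r i ∈ F j) × (∣ F j ∩ F i ∣ ≡ r ∸ 1)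

-- Write a ⇠ b when v_a ∈ F(v_b). In an r-tree every father precedes its child in the
-- rearrangement, which gives (a); and the father v_i of v_j that comes last sees every other
-- father of v_j as an earlier neighbour, so F(v_j) ∖ {v_i} ⊆ F(v_i), which is (b).
-- Conversely, (a) makes ⇠ acyclic, so chains of fathers are shorter than n, and listing V by
-- the length of the longest chain of fathers below each vertex is a valid rearrangement of
-- the graph whose edges are the clique on O and the pairs {v_a, y} with y ∈ F(v_a); each
-- F(v_j) is a clique by induction on that length, using (b). Every realising tree has exactly
-- these edges, and two distinct v_i as in (b) would be fathers of each other, against (a).

module Submission where

open import Defs hiding (sym)
open import Data.Nat using (ℕ; zero; suc; _+_; _∸_; _≤_; _<_; s≤s⁻¹; _≤?_; _<?_) renaming (_≟_ to _≟ℕ_)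
open import Data.Nat.Properties
  using (≤-refl; ≤-reflexive; ≤-trans; <-≤-trans; <⇒≤; <-irrefl; <-asym; <-trans; <-cmp;
         <-resp₂-≡; ≰⇒>; ≤∧≢⇒<; <⇒≱; <⇒≢; m<n⇒m<1+n; n<1+n)
open import Data.Bool using (Bool; true; false) renaming (_≟_ to _≟ᵇ_)
open import Data.Bool.Properties using (⇔→≡)
open import Data.Fin using (Fin; toℕ; fromℕ; fromℕ<; inject₁; splitAt; punchOut; _≟_)
  renaming (zero to fzero; suc to fsuc)
open import Data.Fin.Properties
  using (any?; toℕ-injective; toℕ-fromℕ<; splitAt-↑ˡ; splitAt-↑ʳ; splitAt⁻¹-↑ˡ; splitAt⁻¹-↑ʳ;
         ↑ʳ-injective; injective⇒≤; <⇒notInjective; punchOut-injective)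
open import Data.Fin.Subset
open import Data.Fin.Subset.Properties
open import Data.Fin.Permutation using (Permutation′; permutation; _⟨$⟩ˡ_; _⟨$⟩ʳ_; inverseʳ)
open import Data.Vec using ([]; _∷_; tabulate; here; there)
open import Data.Vec.Properties using (≡-dec; lookup∘tabulate; []=⇒lookup; lookup⇒[]=; tabulate-cong)
open import Data.Product using (Σ; ∃; _×_; _,_; proj₁; proj₂)
open import Data.Product.Function.NonDependent.Propositional using (_×-⇔_)
open import Data.Product.Relation.Binary.Lex.Strict
  using (×-Lex; ×-transitive; ×-irreflexive; ×-decidable; ×-compare)
open import Data.Sum using (_⊎_; inj₁; inj₂; [_,_])
open import Data.Empty using (⊥-elim)
open import Function using (_∘_; _on_; const)
open import Function.Bundles using (_⇔_; mk⇔; Equivalence)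
open import Function.Definitions using (Injective)
open import Function.Properties.Equivalence using () renaming (refl to ⇔-refl; sym to ⇔-sym; trans to ⇔-trans)
open import Relation.Binary using (Rel; tri<; tri≈; tri>)
open import Relation.Binary.PropositionalEquality hiding ([_])
open import Relation.Nullary using (Dec; yes; no; does; ¬_; contradiction)
open import Relation.Nullary.Decidable using (map′; _×-dec_; _⊎-dec_; ¬?; dec-false)
open import Relation.Unary using (Pred; Decidable)

does⇔ : ∀ {p} {P : Set p} (P? : Dec P) → does P? ≡ true ⇔ P
does⇔ (yes p) = mk⇔ (const p) (const refl)
does⇔ (no ¬p) = mk⇔ (λ ()) (λ p → contradiction p ¬p)

argmax : ∀ {m ℓ} {P : Pred (Fin m) ℓ} → Decidable P → (f : Fin m → ℕ) → ∃ P →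
         ∃ λ i → P i × (∀ {j} → P j → f j ≤ f i)
argmax {suc m} {P = P} P? f (i₀ , pi₀) with any? (P? ∘ fsuc)
... | no ∄ = fzero , only-zero i₀ pi₀ , λ {j} → zero-maximal j
  where
  only-zero : ∀ i → P i → P fzero
  only-zero fzero pi = pi
  only-zero (fsuc i) pi = contradiction (i , pi) ∄
  zero-maximal : ∀ j → P j → f j ≤ f fzero
  zero-maximal fzero _ = ≤-refl
  zero-maximal (fsuc j) pj = contradiction (j , pj) ∄
... | yes found with argmax (P? ∘ fsuc) (f ∘ fsuc) found | P? fzero
...   | i , pi , maximal | no ¬p0 = fsuc i , pi , λ { {fzero} p0 → contradiction p0 ¬p0 ; {fsuc j} pj → maximal pj }
...   | i , pi , maximal | yes p0 with f fzero ≤? f (fsuc i)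
...     | yes f0≤fi = fsuc i , pi , λ { {fzero} _ → f0≤fi ; {fsuc j} pj → maximal pj }
...     | no f0≰fi = fzero , p0 , λ { {fzero} _ → ≤-refl ; {fsuc j} pj → ≤-trans (maximal pj) (<⇒≤ (≰⇒> f0≰fi)) }

injective⇒surjective : ∀ {m} {f : Fin m → Fin m} → Injective _≡_ _≡_ f → ∀ y → ∃ λ x → f x ≡ y
injective⇒surjective {suc m} {f} f-inj y with any? (λ x → f x ≟ y)
... | yes found = found
... | no ∄ = contradiction (λ {x} {x′} eq → f-inj (punchOut-injective (missed x) (missed x′) eq))
                           (<⇒notInjective {f = λ x → punchOut (missed x)} (n<1+n m))
  where
  missed : ∀ x → y ≢ f x
  missed x eq = ∄ (x , sym eq)

∈tabulate⇔ : ∀ {m} {x : Fin m} {f : Fin m → Bool} → x ∈ tabulate f ⇔ f x ≡ true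
∈tabulate⇔ {x = x} {f} = mk⇔ (λ h → trans (sym (lookup∘tabulate f x)) ([]=⇒lookup h))
                             (λ e → lookup⇒[]= x _ (trans (lookup∘tabulate f x) e))

∣p∣≡1+∣p-x∣ : ∀ {m} {x : Fin m} {p : Subset m} → x ∈ p → ∣ p ∣ ≡ suc ∣ p - x ∣
∣p∣≡1+∣p-x∣ {p = inside ∷ p} here = cong (suc ∘ ∣_∣) (sym (p─⊥≡p p))
∣p∣≡1+∣p-x∣ {p = inside ∷ p} (there x∈p) = cong suc (∣p∣≡1+∣p-x∣ x∈p)
∣p∣≡1+∣p-x∣ {p = outside ∷ p} (there x∈p) = ∣p∣≡1+∣p-x∣ x∈p

x∉p-x : ∀ {m} (p : Subset m) {x} → x ∉ p - x
x∉p-x (outside ∷ p) {fzero} ()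
x∉p-x (inside ∷ p) {fzero} ()
x∉p-x (_ ∷ p) {fsuc x} (there h) = x∉p-x p h

x∈p-y⁻ : ∀ {m} {p : Subset m} {x y} → x ∈ p - y → x ∈ p × x ≢ y
x∈p-y⁻ {p = p} {y = y} h = p─q⊆p p ⁅ y ⁆ h , λ { refl → x∉p-x p h }

p⊆q∧∣q∣≤∣p∣⇒p≡q : ∀ {m} {p q : Subset m} → p ⊆ q → ∣ q ∣ ≤ ∣ p ∣ → p ≡ q
p⊆q∧∣q∣≤∣p∣⇒p≡q {p = p} {q} p⊆q ∣q∣≤∣p∣ = ⊆-antisym p⊆q q⊆p
  where
  q⊆p : q ⊆ p
  q⊆p {x} x∈q with x ∈? p
  ... | yes x∈p = x∈p
  ... | no x∉p = contradiction ∣q∣≤∣p∣ (<⇒≱ (p⊂q⇒∣p∣<∣q∣ (p⊆q , x , x∈q , x∉p)))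

p-x⊆q⇔∣p∩q∣≡∣p∣∸1 : ∀ {m} {x : Fin m} {p q : Subset m} → x ∈ p → x ∉ q →
                     p - x ⊆ q ⇔ ∣ p ∩ q ∣ ≡ ∣ p ∣ ∸ 1
p-x⊆q⇔∣p∩q∣≡∣p∣∸1 {x = x} {p} {q} x∈p x∉q = mk⇔ size-drop fill-up
  where
  ∣p-x∣≡∣p∣∸1 : ∣ p - x ∣ ≡ ∣ p ∣ ∸ 1
  ∣p-x∣≡∣p∣∸1 = sym (cong (_∸ 1) (∣p∣≡1+∣p-x∣ x∈p))
  p∩q⊆p-x : p ∩ q ⊆ p - x
  p∩q⊆p-x h with z∈p , z∈q ← x∈p∩q⁻ p q h = x∈p∧x≢y⇒x∈p-y z∈p (λ { refl → x∉q z∈q })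
  size-drop : p - x ⊆ q → ∣ p ∩ q ∣ ≡ ∣ p ∣ ∸ 1
  size-drop p-x⊆q = trans (cong ∣_∣ (⊆-antisym p∩q⊆p-x p-x⊆p∩q)) ∣p-x∣≡∣p∣∸1
    where
    p-x⊆p∩q : p - x ⊆ p ∩ q
    p-x⊆p∩q h = x∈p∩q⁺ (p─q⊆p p ⁅ x ⁆ h , p-x⊆q h)
  fill-up : ∣ p ∩ q ∣ ≡ ∣ p ∣ ∸ 1 → p - x ⊆ q
  fill-up eq h = p∩q⊆q p q (subst (_ ∈_) (sym p∩q≡p-x) h)
    where
    p∩q≡p-x : p ∩ q ≡ p - x
    p∩q≡p-x = p⊆q∧∣q∣≤∣p∣⇒p≡q p∩q⊆p-x (≤-reflexive (trans ∣p-x∣≡∣p∣∸1 (sym eq)))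

module SortByKey {n} (key : Fin n → ℕ) where

  private
    pair : Fin n → ℕ × ℕ
    pair a = key a , toℕ a

    _<ₗₑₓ_ : Rel (ℕ × ℕ) _
    _<ₗₑₓ_ = ×-Lex _≡_ _<_ _<_

  _≺_ : Rel (Fin n) _
  _≺_ = _<ₗₑₓ_ on pair

  ≺-trans : ∀ {a b c} → a ≺ b → b ≺ c → a ≺ c
  ≺-trans {a} {b} {c} = ×-transitive {_≈₁_ = _≡_} {_<₁_ = _<_} {_<₂_ = _<_}
    isEquivalence <-resp₂-≡ <-trans <-trans {pair a} {pair b} {pair c}

  ≺-irrefl : ∀ {a} → ¬ a ≺ a
  ≺-irrefl {a} = ×-irreflexive {_≈₁_ = _≡_} {_<₁_ = _<_} {_≈₂_ = _≡_} {_<₂_ = _<_}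
    <-irrefl <-irrefl {pair a} {pair a} (refl , refl)

  ≺-connex : ∀ {a b} → a ≢ b → a ≺ b ⊎ b ≺ a
  ≺-connex {a} {b} a≢b with ×-compare sym <-cmp <-cmp (pair a) (pair b)
  ... | tri< a≺b _ _ = inj₁ a≺b
  ... | tri≈ _ (_ , eq) _ = contradiction (toℕ-injective eq) a≢b
  ... | tri> _ _ b≺a = inj₂ b≺a

  ≺-decidable : ∀ a b → Dec (a ≺ b)
  ≺-decidable a b = ×-decidable {_≈₁_ = _≡_} {_<₁_ = _<_} {_<₂_ = _<_} _≟ℕ_ _<?_ _<?_ (pair a) (pair b)

  predecessors : Fin n → Subset n
  predecessors a = tabulate λ j → does (≺-decidable j a)

  ∈predecessors⇔ : ∀ {a j} → j ∈ predecessors a ⇔ j ≺ a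
  ∈predecessors⇔ {a} {j} = ⇔-trans ∈tabulate⇔ (does⇔ (≺-decidable j a))

  ≺⇒∣predecessors∣< : ∀ {a b} → a ≺ b → ∣ predecessors a ∣ < ∣ predecessors b ∣
  ≺⇒∣predecessors∣< a≺b = p⊂q⇒∣p∣<∣q∣
    ( (λ j≺a → Equivalence.from ∈predecessors⇔ (≺-trans (Equivalence.to ∈predecessors⇔ j≺a) a≺b))
    , _ , Equivalence.from ∈predecessors⇔ a≺b , ≺-irrefl ∘ Equivalence.to ∈predecessors⇔ )

  ∣predecessors∣<n : ∀ a → ∣ predecessors a ∣ < n
  ∣predecessors∣<n a = subst (∣ predecessors a ∣ <_) (∣⊤∣≡n n)
    (p⊂q⇒∣p∣<∣q∣ (⊆⊤ , a , ∈⊤ , ≺-irrefl ∘ Equivalence.to ∈predecessors⇔))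

  rank : Fin n → Fin n
  rank a = fromℕ< (∣predecessors∣<n a)

  ≺⇒rank< : ∀ {a b} → a ≺ b → toℕ (rank a) < toℕ (rank b)
  ≺⇒rank< {a} {b} a≺b = subst₂ _<_ (sym (toℕ-fromℕ< _)) (sym (toℕ-fromℕ< _)) (≺⇒∣predecessors∣< a≺b)

  rank-injective : Injective _≡_ _≡_ rank
  rank-injective {a} {b} eq with a ≟ b
  ... | yes a≡b = a≡b
  ... | no a≢b with ≺-connex a≢b
  ...   | inj₁ a≺b = contradiction (cong toℕ eq) (<⇒≢ (≺⇒rank< a≺b))
  ...   | inj₂ b≺a = contradiction (cong toℕ (sym eq)) (<⇒≢ (≺⇒rank< b≺a))

  ν : Permutation′ n
  ν = permutation (proj₁ ∘ rank-surjective) rank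
        (λ a → rank-injective (proj₂ (rank-surjective (rank a)))) (proj₂ ∘ rank-surjective)
    where
    rank-surjective : ∀ p → ∃ λ a → rank a ≡ p
    rank-surjective = injective⇒surjective rank-injective

  key<⇒position< : ∀ {a b} → key a < key b → toℕ (ν ⟨$⟩ˡ a) < toℕ (ν ⟨$⟩ˡ b)
  key<⇒position< = ≺⇒rank< ∘ inj₁

module _ {r n : ℕ} where

  data View : Fin (r + n) → Set where
    isO : (k : Fin r) → View (o n k)
    isV : (a : Fin n) → View (v r a)

  view : ∀ x → View x
  view x with splitAt r x in eq
  ... | inj₁ k = subst View (splitAt⁻¹-↑ˡ eq) (isO k)
  ... | inj₂ a = subst View (splitAt⁻¹-↑ʳ eq) (isV a)

  v-injective : ∀ {a b} → v r {n} a ≡ v r b → a ≡ b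
  v-injective = ↑ʳ-injective r _ _

  module _ (f : Fin r ⊎ Fin n → Bool) where

    o∈tabulate⇔ : ∀ {k} → o n k ∈ tabulate (f ∘ splitAt r) ⇔ f (inj₁ k) ≡ true
    o∈tabulate⇔ {k} = subst (λ s → o n k ∈ tabulate (f ∘ splitAt r) ⇔ f s ≡ true) (splitAt-↑ˡ r k n) ∈tabulate⇔

    v∈tabulate⇔ : ∀ {a} → v r a ∈ tabulate (f ∘ splitAt r) ⇔ f (inj₂ a) ≡ true
    v∈tabulate⇔ {a} = subst (λ s → v r a ∈ tabulate (f ∘ splitAt r) ⇔ f s ≡ true) (splitAt-↑ʳ r n a) ∈tabulate⇔

  o∈Oset : ∀ k → o n k ∈ Oset r n
  o∈Oset k = Equivalence.from (o∈tabulate⇔ [ const true , const false ]) refl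

  v∉Oset : ∀ a → v r a ∉ Oset r n
  v∉Oset a h with () ← Equivalence.to (v∈tabulate⇔ [ const true , const false ]) h

∣Oset∣ : ∀ r n → ∣ Oset r n ∣ ≡ r
∣Oset∣ zero n = trans (cong ∣_∣ (Empty-unique {p = Oset zero n} λ (x , x∈O) → v∉Oset x x∈O)) (∣⊥∣≡0 n)
∣Oset∣ (suc r) n = cong suc (trans (cong ∣_∣ (tabulate-cong shift)) (∣Oset∣ r n))
  where
  isO? : ∀ {k} → Fin k ⊎ Fin n → Bool
  isO? = [ const true , const false ]
  shift : ∀ x → isO? (splitAt (suc r) (fsuc x)) ≡ isO? (splitAt r x)
  shift x with splitAt r x
  ... | inj₁ _ = refl
  ... | inj₂ _ = refl

adj⇒≢ : ∀ {m} (T : Graph m) {x y} → adj T x y ≡ true → x ≢ y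
adj⇒≢ T {x} e refl = contradiction (trans (sym e) (irrefl T x)) λ ()

module Positions {r n : ℕ} (ν : Permutation′ n) where

  pos : Fin n → ℕ
  pos a = toℕ (ν ⟨$⟩ˡ a)

  pos-injective : ∀ {a b} → pos a ≡ pos b → a ≡ b
  pos-injective {a} {b} eq = trans (sym (inverseʳ ν)) (trans (cong (ν ⟨$⟩ʳ_) (toℕ-injective eq)) (inverseʳ ν))

  private
    earlier : Fin n → Fin n → Bool
    earlier i a = does (pos a <? pos i)

  o∈Before : ∀ k i → o n k ∈ Before r ν i
  o∈Before k i = Equivalence.from (o∈tabulate⇔ [ const true , earlier i ]) refl

  v∈Before⇔ : ∀ {a i} → v r a ∈ Before r ν i ⇔ pos a < pos i
  v∈Before⇔ {a} {i} = ⇔-trans (v∈tabulate⇔ [ const true , earlier i ]) (does⇔ (pos a <? pos i))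

  ∈Fathers⇔ : ∀ T {x i} → x ∈ Fathers r T ν i ⇔ (adj T (v r i) x ≡ true × x ∈ Before r ν i)
  ∈Fathers⇔ _ = ⇔-trans ∩⇔× (∈tabulate⇔ ×-⇔ ⇔-refl)

module FatherMap {r n : ℕ} (F : Fin n → Subset (r + n)) where

  infix 4 _⇠_
  _⇠_ : Fin n → Fin n → Set
  a ⇠ b = v r a ∈ F b

  infixr 5 _∷_
  data Path : Fin n → Fin n → ℕ → Set where
    [] : ∀ {a} → Path a a 0
    _∷_ : ∀ {a b c k} → a ⇠ b → Path b c k → Path a c (suc k)

  _∷ʳ_ : ∀ {a b c k} → Path a b k → b ⇠ c → Path a c (suc k)
  [] ∷ʳ e = e ∷ []
  (e′ ∷ p) ∷ʳ e = e′ ∷ (p ∷ʳ e)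

  path? : ∀ k a b → Dec (Path a b k)
  path? zero a b = map′ (λ { refl → [] }) (λ { [] → refl }) (a ≟ b)
  path? (suc k) a b = map′ (λ (_ , e , p) → e ∷ p) (λ { (e ∷ p) → _ , e , p })
                           (any? λ c → (v r a ∈? F c) ×-dec path? k c b)

  vertex : ∀ {a b k} → Path a b k → Fin (suc k) → Fin n
  vertex {a} _ fzero = a
  vertex (_ ∷ p) (fsuc i) = vertex p i

  vertex-last : ∀ {a b k} (p : Path a b k) → vertex p (fromℕ k) ≡ b
  vertex-last [] = refl
  vertex-last (_ ∷ p) = vertex-last p

  vertex-step : ∀ {a b k} (p : Path a b k) m → vertex p (inject₁ m) ⇠ vertex p (fsuc m)
  vertex-step (e ∷ _) fzero = e
  vertex-step (_ ∷ p) (fsuc m) = vertex-step p m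

  prefix : ∀ {a b k} (p : Path a b k) i → Path a (vertex p i) (toℕ i)
  prefix _ fzero = []
  prefix (e ∷ p) (fsuc i) = e ∷ prefix p i

  monotone⇒acyclic : (h : Fin n → ℕ) → (∀ {a b} → a ⇠ b → h a < h b) → CondA r F
  monotone⇒acyclic h mono k is steps back = <⇒≱ (mono back) (chain k is steps)
    where
    chain : ∀ k (is : Fin (suc k) → Fin n) → (∀ m → is (inject₁ m) ⇠ is (fsuc m)) →
            h (is fzero) ≤ h (is (fromℕ k))
    chain zero is steps = ≤-refl
    chain (suc k) is steps = ≤-trans (chain k (is ∘ inject₁) (steps ∘ inject₁)) (<⇒≤ (mono (steps (fromℕ k))))

  parents : Fin (r + n) → Subset (r + n)
  parents x = [ const ⊥ , F ] (splitAt r x)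

  parents-v : ∀ a → parents (v r a) ≡ F a
  parents-v a = cong [ const ⊥ , F ] (splitAt-↑ʳ r n a)

  ∉parents-o : ∀ k {x} → x ∉ parents (o n k)
  ∉parents-o k h = ∉⊥ (subst (_ ∈_) (cong [ const ⊥ , F ] (splitAt-↑ˡ r k n)) h)

  data Edge (x y : Fin (r + n)) : Set where
    root : x ∈ Oset r n → y ∈ Oset r n → x ≢ y → Edge x y
    down : y ∈ parents x → Edge x y
    up   : x ∈ parents y → Edge x y

  down-v : ∀ {a y} → y ∈ F a → Edge (v r a) y
  down-v {a} h = down (subst (_ ∈_) (sym (parents-v a)) h)

  up-v : ∀ {a x} → x ∈ F a → Edge x (v r a)
  up-v {a} h = up (subst (_ ∈_) (sym (parents-v a)) h)

  Edge-sym : ∀ {x y} → Edge x y → Edge y x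
  Edge-sym (root x∈O y∈O x≢y) = root y∈O x∈O (x≢y ∘ sym)
  Edge-sym (down h) = up h
  Edge-sym (up h) = down h

  edge? : ∀ x y → Dec (Edge x y)
  edge? x y = map′ fromCases toCases
    (((x ∈? Oset r n) ×-dec (y ∈? Oset r n) ×-dec ¬? (x ≟ y)) ⊎-dec (y ∈? parents x) ⊎-dec (x ∈? parents y))
    where
    Cases : Set
    Cases = (x ∈ Oset r n × y ∈ Oset r n × x ≢ y) ⊎ y ∈ parents x ⊎ x ∈ parents y
    fromCases : Cases → Edge x y
    fromCases (inj₁ (x∈O , y∈O , x≢y)) = root x∈O y∈O x≢y
    fromCases (inj₂ (inj₁ h)) = down h
    fromCases (inj₂ (inj₂ h)) = up h
    toCases : Edge x y → Cases
    toCases (root x∈O y∈O x≢y) = inj₁ (x∈O , y∈O , x≢y)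
    toCases (down h) = inj₂ (inj₁ h)
    toCases (up h) = inj₂ (inj₂ h)

  module Acyclic (acyclic : CondA r F) where

    path-acyclic : ∀ {a b k} → Path a b k → ¬ b ⇠ a
    path-acyclic {a} {k = k} p back =
      acyclic k (vertex p) (vertex-step p) (subst (λ c → c ⇠ a) (sym (vertex-last p)) back)

    ⇠-irrefl : ∀ {a} → ¬ a ⇠ a
    ⇠-irrefl = path-acyclic []

    ⇠-asym : ∀ {a b} → a ⇠ b → ¬ b ⇠ a
    ⇠-asym e = path-acyclic (e ∷ [])

    vertex-injective : ∀ {a b k} (p : Path a b k) → Injective _≡_ _≡_ (vertex p)
    vertex-injective p {fzero} {fzero} _ = refl
    vertex-injective (e ∷ p) {fzero} {fsuc j} eq = contradiction (subst (_⇠ _) eq e) (path-acyclic (prefix p j))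
    vertex-injective (e ∷ p) {fsuc i} {fzero} eq = contradiction (subst (_⇠ _) (sym eq) e) (path-acyclic (prefix p i))
    vertex-injective (_ ∷ p) {fsuc i} {fsuc j} eq = cong fsuc (vertex-injective p eq)

    path-length : ∀ {a b k} → Path a b k → k < n
    path-length p = injective⇒≤ (vertex-injective p)

    -- Paths are shorter than n, so the maximum over Fin (suc n) is the longest path ending at b.
    private
      deepest : ∀ b → ∃ λ (m : Fin (suc n)) → (∃ λ a → Path a b (toℕ m))
                       × (∀ {m′} → (∃ λ a → Path a b (toℕ m′)) → toℕ m′ ≤ toℕ m)
      deepest b = argmax (λ m → any? λ a → path? (toℕ m) a b) toℕ (fzero , b , [])

    height : Fin n → ℕ
    height b = toℕ (proj₁ (deepest b))

    path-to-height : ∀ b → ∃ λ a → Path a b (height b)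
    path-to-height b = proj₁ (proj₂ (deepest b))

    path⇒≤height : ∀ {a b k} → Path a b k → k ≤ height b
    path⇒≤height {a} {b} {k} p = subst (_≤ height b) (toℕ-fromℕ< k<1+n)
      (proj₂ (proj₂ (deepest b)) (a , subst (Path a b) (sym (toℕ-fromℕ< k<1+n)) p))
      where
      k<1+n : k < suc n
      k<1+n = m<n⇒m<1+n (path-length p)

    height-monotone : ∀ {a b} → a ⇠ b → height a < height b
    height-monotone {a} e = path⇒≤height (proj₂ (path-to-height a) ∷ʳ e)

    shares-all-but : ∀ {i j} → i ⇠ j → ∣ F j ∩ F i ∣ ≡ ∣ F j ∣ ∸ 1 → F j - v r i ⊆ F i
    shares-all-but i⇠j = Equivalence.from (p-x⊆q⇔∣p∩q∣≡∣p∣∸1 i⇠j ⇠-irrefl)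

    shared-father-unique : ∀ {i i′ j} → i ⇠ j → ∣ F j ∩ F i ∣ ≡ ∣ F j ∣ ∸ 1 →
                           i′ ⇠ j → ∣ F j ∩ F i′ ∣ ≡ ∣ F j ∣ ∸ 1 → i ≡ i′
    shared-father-unique {i} {i′} i⇠j shares i′⇠j shares′ with i ≟ i′
    ... | yes i≡i′ = i≡i′
    ... | no i≢i′ = ⊥-elim (⇠-asym (shares-all-but i⇠j shares (x∈p∧x≢y⇒x∈p-y i′⇠j (i≢i′ ∘ sym ∘ v-injective)))
                          (shares-all-but i′⇠j shares′ (x∈p∧x≢y⇒x∈p-y i⇠j (i≢i′ ∘ v-injective))))

    parents-irrefl : ∀ {x} → x ∉ parents x
    parents-irrefl {x} with view {r} {n} x
    ... | isO k = ∉parents-o k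
    ... | isV a = ⇠-irrefl ∘ subst (_ ∈_) (parents-v a)

    Edge-irrefl : ∀ {x} → ¬ Edge x x
    Edge-irrefl (root _ _ x≢x) = x≢x refl
    Edge-irrefl (down h) = parents-irrefl h
    Edge-irrefl (up h) = parents-irrefl h

  module Realisation (T : Graph (r + n)) (ν : Permutation′ n) (valid : ValidRearrangement r T ν)
                     (realises : ∀ i → F i ≡ Fathers r T ν i) where
    open Positions {r} ν

    ∈F⇔ : ∀ {i x} → x ∈ F i ⇔ (adj T (v r i) x ≡ true × x ∈ Before r ν i)
    ∈F⇔ {i} {x} = subst (λ s → x ∈ s ⇔ _) (sym (realises i)) (∈Fathers⇔ T)

    ⇠⇒pos< : ∀ {a b} → a ⇠ b → pos a < pos b
    ⇠⇒pos< = Equivalence.to v∈Before⇔ ∘ proj₂ ∘ Equivalence.to ∈F⇔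

    realised-acyclic : CondA r F
    realised-acyclic = monotone⇒acyclic pos ⇠⇒pos<

    open Acyclic realised-acyclic using (⇠-irrefl)

    ∣F∣≡r : ∀ i → ∣ F i ∣ ≡ r
    ∣F∣≡r i = trans (cong ∣_∣ (realises i)) (proj₁ (valid i))

    F-clique : ∀ i → Clique T (F i)
    F-clique i = subst (Clique T) (sym (realises i)) (proj₂ (valid i))

    realised-condB : CondB r F
    realised-condB j F≢O with any? (λ a → v r a ∈? F j)
    ... | no ∄ = contradiction (p⊆q∧∣q∣≤∣p∣⇒p≡q F⊆O (≤-reflexive (trans (∣Oset∣ r n) (sym (∣F∣≡r j))))) F≢O
      where
      F⊆O : F j ⊆ Oset r n
      F⊆O {x} h with view {r} {n} x
      ... | isO k = o∈Oset k
      ... | isV a = contradiction (a , h) ∄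
    ... | yes found with i , i⇠j , latest ← argmax (λ a → v r a ∈? F j) pos found =
      i , i⇠j , trans (Equivalence.to (p-x⊆q⇔∣p∩q∣≡∣p∣∸1 i⇠j ⇠-irrefl) F-i⊆F) (cong (_∸ 1) (∣F∣≡r j))
      where
      before-i : ∀ {z} → z ∈ F j → z ≢ v r i → z ∈ Before r ν i
      before-i {z} z∈F z≢vi with view {r} {n} z
      ... | isO k = o∈Before k i
      ... | isV b = Equivalence.from v∈Before⇔ (≤∧≢⇒< (latest z∈F) (z≢vi ∘ cong (v r) ∘ pos-injective))
      F-i⊆F : F j - v r i ⊆ F i
      F-i⊆F h with z∈F , z≢vi ← x∈p-y⁻ h =
        Equivalence.from ∈F⇔ (F-clique j _ _ i⇠j z∈F (z≢vi ∘ sym) , before-i z∈F z≢vi)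

    adj-sym : ∀ {x y} → adj T x y ≡ true → adj T y x ≡ true
    adj-sym = trans (Graph.sym T _ _)

    parent⇒adj : ∀ {x y} → y ∈ parents x → adj T x y ≡ true
    parent⇒adj {x} h with view {r} {n} x
    ... | isO k = contradiction h (∉parents-o k)
    ... | isV a = proj₁ (Equivalence.to ∈F⇔ (subst (_ ∈_) (parents-v a) h))

    earlier-neighbour : ∀ {b y} → adj T (v r b) y ≡ true → y ∈ Before r ν b → Edge (v r b) y
    earlier-neighbour e before = down-v (Equivalence.from ∈F⇔ (e , before))

    module _ (O-clique : Clique T (Oset r n)) where

      Edge⇒adj : ∀ {x y} → Edge x y → adj T x y ≡ true
      Edge⇒adj (root x∈O y∈O x≢y) = O-clique _ _ x∈O y∈O x≢y
      Edge⇒adj (down y∈) = parent⇒adj y∈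
      Edge⇒adj (up x∈) = adj-sym (parent⇒adj x∈)

      adj⇒Edge : ∀ {x y} → adj T x y ≡ true → Edge x y
      adj⇒Edge {x} {y} e with view {r} {n} x | view {r} {n} y
      ... | isO k | isO k′ = root (o∈Oset k) (o∈Oset k′) (adj⇒≢ T e)
      ... | isO k | isV b = Edge-sym (earlier-neighbour (adj-sym e) (o∈Before k b))
      ... | isV a | isO k = earlier-neighbour e (o∈Before k a)
      ... | isV a | isV b with <-cmp (pos a) (pos b)
      ...   | tri< a<b _ _ = Edge-sym (earlier-neighbour (adj-sym e) (Equivalence.from v∈Before⇔ a<b))
      ...   | tri≈ _ a≈b _ = contradiction (cong (v r) (pos-injective a≈b)) (adj⇒≢ T e)
      ...   | tri> _ _ b<a = earlier-neighbour e (Equivalence.from v∈Before⇔ b<a)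

      adj⇔Edge : ∀ {x y} → adj T x y ≡ true ⇔ Edge x y
      adj⇔Edge = mk⇔ adj⇒Edge Edge⇒adj

  module Construction (∣F∣≡r : ∀ i → ∣ F i ∣ ≡ r) (acyclic : CondA r F) (condB : CondB r F) where
    open Acyclic acyclic
    open SortByKey height using (ν; key<⇒position<)
    open Positions {r} ν

    tree : Graph (r + n)
    tree = record
      { adj = λ x y → does (edge? x y)
      ; sym = λ x y → ⇔→≡ (⇔-trans (does⇔ (edge? x y)) (⇔-trans (mk⇔ Edge-sym Edge-sym) (⇔-sym (does⇔ (edge? y x)))))
      ; irrefl = λ x → dec-false (edge? x x) Edge-irrefl
      }

    Edge⇒adj : ∀ {x y} → Edge x y → adj tree x y ≡ true
    Edge⇒adj = Equivalence.from (does⇔ (edge? _ _))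

    ⇠⇒pos< : ∀ {a b} → a ⇠ b → pos a < pos b
    ⇠⇒pos< = key<⇒position< ∘ height-monotone

    Fathers≡F : ∀ i → Fathers r tree ν i ≡ F i
    Fathers≡F i = ⊆-antisym Fathers⊆F F⊆Fathers
      where
      Fathers⊆F : Fathers r tree ν i ⊆ F i
      Fathers⊆F {x} h with Equivalence.to (does⇔ (edge? _ _)) (proj₁ (Equivalence.to (∈Fathers⇔ tree) h))
                         | proj₂ (Equivalence.to (∈Fathers⇔ tree) h)
      ... | root vi∈O _ _ | _ = contradiction vi∈O (v∉Oset i)
      ... | down x∈ | _ = subst (x ∈_) (parents-v i) x∈
      ... | up vi∈ | x-before with view {r} {n} x
      ...   | isO k = contradiction vi∈ (∉parents-o k)
      ...   | isV b = ⊥-elim (<-asym (⇠⇒pos< (subst (_ ∈_) (parents-v b) vi∈)) (Equivalence.to v∈Before⇔ x-before))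
      F⊆Fathers : F i ⊆ Fathers r tree ν i
      F⊆Fathers {x} h = Equivalence.from (∈Fathers⇔ tree) (Edge⇒adj (down-v h) , before h)
        where
        before : x ∈ F i → x ∈ Before r ν i
        before h with view {r} {n} x
        ... | isO k = o∈Before k i
        ... | isV b = Equivalence.from v∈Before⇔ (⇠⇒pos< h)

    O-clique : Clique tree (Oset r n)
    O-clique _ _ x∈O y∈O x≢y = Edge⇒adj (root x∈O y∈O x≢y)

    F-clique : ∀ m i → height i < m → Clique tree (F i)
    F-clique (suc m) i h<m with ≡-dec _≟ᵇ_ (F i) (Oset r n)
    ... | yes F≡O = subst (Clique tree) (sym F≡O) O-clique
    ... | no F≢O with a , a⇠i , shares ← condB i F≢O = clique
      where
      F-a⊆F : ∀ {z} → z ∈ F i → z ≢ v r a → z ∈ F a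
      F-a⊆F z∈F z≢va = shares-all-but a⇠i (trans shares (cong (_∸ 1) (sym (∣F∣≡r i))))
                         (x∈p∧x≢y⇒x∈p-y z∈F z≢va)
      clique : Clique tree (F i)
      clique x y x∈ y∈ x≢y with x ≟ v r a | y ≟ v r a
      ... | yes refl | yes refl = contradiction refl x≢y
      ... | yes refl | no y≢va = Edge⇒adj (down-v (F-a⊆F y∈ y≢va))
      ... | no x≢va | yes refl = Edge⇒adj (up-v (F-a⊆F x∈ x≢va))
      ... | no x≢va | no y≢va =
        F-clique m a (<-≤-trans (height-monotone a⇠i) (s≤s⁻¹ h<m)) x y (F-a⊆F x∈ x≢va) (F-a⊆F y∈ y≢va) x≢y

    tree-is-O-rooted : IsORootedRTree r n tree
    tree-is-O-rooted = O-clique , ν , λ i →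
      subst (λ s → ∣ s ∣ ≡ r × Clique tree s) (sym (Fathers≡F i)) (∣F∣≡r i , F-clique _ i (n<1+n _))

  RealisingTree : Set
  RealisingTree = Σ (Graph (r + n)) λ T → Σ (IsORootedRTree r n T) λ isT → ∀ i → F i ≡ FatherSet r T isT i

  realisable⇒conditions : RealisingTree → CondA r F × CondB r F
  realisable⇒conditions (T , (_ , ν , valid) , realises) = realised-acyclic , realised-condB
    where open Realisation T ν valid realises

  conditions⇒realisable : (∀ i → ∣ F i ∣ ≡ r) → CondA r F × CondB r F → RealisingTree
  conditions⇒realisable ∣F∣≡r (acyclic , condB) = tree , tree-is-O-rooted , sym ∘ Fathers≡F
    where open Construction ∣F∣≡r acyclic condB

  realisations-agree : (R R′ : RealisingTree) → ∀ x y → adj (proj₁ R) x y ≡ adj (proj₁ R′) x y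
  realisations-agree (T , (O-clique , ν , valid) , realises) (T′ , (O-clique′ , ν′ , valid′) , realises′) x y =
    ⇔→≡ (⇔-trans (Realisation.adj⇔Edge T ν valid realises O-clique)
                 (⇔-sym (Realisation.adj⇔Edge T′ ν′ valid′ realises′ O-clique′)))

proposition3p5 : (r n : ℕ) (F : Fin n → Subset (r + n)) → (∀ i → ∣ F i ∣ ≡ r) →
    ((Σ (Graph (r + n)) λ T → Σ (IsORootedRTree r n T) λ isT → ∀ i → F i ≡ FatherSet r T isT i)
      ⇔ (CondA r F × CondB r F))
    × (∀ (T T′ : Graph (r + n)) (isT : IsORootedRTree r n T) (isT′ : IsORootedRTree r n T′) →
        (∀ i → F i ≡ FatherSet r T isT i) → (∀ i → F i ≡ FatherSet r T′ isT′ i) →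
        ∀ x y → adj T x y ≡ adj T′ x y)
    × (CondA r F → CondB r F → ∀ (j i i′ : Fin n) → F j ≢ Oset r n →
        v r i ∈ F j → ∣ F j ∩ F i ∣ ≡ r ∸ 1 →
        v r i′ ∈ F j → ∣ F j ∩ F i′ ∣ ≡ r ∸ 1 → i ≡ i′)
proposition3p5 r n F ∣F∣≡r =
    mk⇔ realisable⇒conditions (conditions⇒realisable ∣F∣≡r)
  , (λ T T′ isT isT′ realises realises′ → realisations-agree (T , isT , realises) (T′ , isT′ , realises′))
  , λ acyclic _ j _ _ _ i⇠j shares i′⇠j shares′ →
      Acyclic.shared-father-unique acyclic i⇠j (trans shares (r∸1 j)) i′⇠j (trans shares′ (r∸1 j))
  where
  open FatherMap F

  r∸1 : ∀ j → r ∸ 1 ≡ ∣ F j ∣ ∸ 1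
  r∸1 j = cong (_∸ 1) (sym (∣F∣≡r j))
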